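{- The graphs $\mathbf{X}_6$ and $\mathbf{X}_7$ are of finite mutation type, i.e. each of them is mutation-finite.
   Context: A graph (quiver) here is a finite directed multigraph without loops and without oriented 2-cycles. For a vertex $k$ of such a graph $\Gamma$, the mutation $\mu_k\Gamma$ is obtained as follows: for every arrow $a:i\to k$ and every arrow $b:k\to j$ add a new arrow $i\to j$; then reverse every arrow starting or ending at $k$; finally remove pairs of opposite arrows (2-cycles) until none remain. Two graphs are mutation-equivalent if one is obtained from the other by a sequence of mutations and relabeling of vertices. The mutation class of $\Gamma$ is the set of isomorphism classes of graphs mutation-equivalent to $\Gamma$; $\Gamma$ is mutation-finite (of finite mutation type) if its mutation class is finite. $\mathbf{X}_6$ is the graph with vertices $x,y_1,z_1,y_2,z_2,w$ and arrows: two arrows $y_1\to z_1$, one arrow $z_1\to x$, one arrow $x\to y_1$, one arrow $x\to y_2$, two arrows $y_2\to z_2$, one arrow $z_2\to x$, one arrow $w\to x$. $\mathbf{X}_7$ is the graph with vertices $x,y_1,z_1,y_2,z_2,y_3,z_3$ and arrows: for each $i=1,2,3$, one arrow $x\to y_i$, two arrows $y_i\to z_i$, and one arrow $z_i\to x$. -}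

module Defs where

open import Data.Nat using (ℕ; zero; suc; _+_; _*_; _∸_)
open import Data.Fin using (Fin; toℕ; _≟_)
open import Data.Fin.Permutation using (Permutation′; _⟨$⟩ʳ_)
open import Data.Product using (Σ; ∃; _×_; _,_)
open import Data.Sum using (_⊎_)
open import Data.List using (List)
open import Data.List.Relation.Unary.Any using (Any)
open import Relation.Nullary using (Dec; yes; no)
open import Relation.Binary.PropositionalEquality using (_≡_)
open import Relation.Binary.Construct.Closure.ReflexiveTransitive using (Star)

-- A graph on the vertex set Fin n, given by its arrow multiplicities:
-- arrows i j = number of arrows i → j.
Graph : ℕ → Set
Graph n = Fin n → Fin n → ℕ

IsQuiver : ∀ {n} → Graph n → Set
IsQuiver {n} Γ = (∀ (i : Fin n) → Γ i i ≡ 0) × (∀ (i j : Fin n) → Γ i j ≡ 0 ⊎ Γ j i ≡ 0)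

-- Mutation at k.
--  * arrows touching k are reversed;
--  * for i, j ≠ k: first add (#i→k)·(#k→j) arrows i → j, then cancel
--    opposite pairs, which leaves (p ∸ q) arrows i → j where p, q are the
--    numbers of arrows i → j and j → i after the addition step.
mutAux : ∀ {n} → Graph n → (k i j : Fin n) → Dec (i ≡ k) → Dec (j ≡ k) → ℕ
mutAux Γ k i j (yes _) _       = Γ j i
mutAux Γ k i j (no _)  (yes _) = Γ j i
mutAux Γ k i j (no _)  (no _)  =
  (Γ i j + Γ i k * Γ k j) ∸ (Γ j i + Γ j k * Γ k i)

mutate : ∀ {n} → Fin n → Graph n → Graph n
mutate k Γ i j = mutAux Γ k i j (i ≟ k) (j ≟ k)

Iso : ∀ {n} → Graph n → Graph n → Set
Iso {n} Γ Δ = Σ (Permutation′ n) λ σ → ∀ (i j : Fin n) → Δ (σ ⟨$⟩ʳ i) (σ ⟨$⟩ʳ j) ≡ Γ i j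

data Move {n : ℕ} : Graph n → Graph n → Set where
  mut   : ∀ {Γ} (k : Fin n) → Move Γ (mutate k Γ)
  relab : ∀ {Γ Δ} → Iso Γ Δ → Move Γ Δ

MutEquiv : ∀ {n} → Graph n → Graph n → Set
MutEquiv = Star Move

-- mutation-finite: finitely many isomorphism classes in the mutation class,
-- i.e. some finite list of graphs represents every graph mutation-equivalent to Γ
MutationFinite : ∀ {n} → Graph n → Set
MutationFinite {n} Γ =
  Σ (List (Graph n)) λ L → ∀ (Δ : Graph n) → MutEquiv Γ Δ → Any (Iso Δ) L

-- X₆ : vertices x=0, y₁=1, z₁=2, y₂=3, z₂=4, w=5
x6 : ℕ → ℕ → ℕ
x6 1 2 = 2
x6 2 0 = 1
x6 0 1 = 1
x6 0 3 = 1
x6 3 4 = 2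
x6 4 0 = 1
x6 5 0 = 1
x6 _ _ = 0

X₆ : Graph 6
X₆ i j = x6 (toℕ i) (toℕ j)

-- X₇ : vertices x=0, y₁=1, z₁=2, y₂=3, z₂=4, y₃=5, z₃=6
x7 : ℕ → ℕ → ℕ
x7 0 1 = 1
x7 0 3 = 1
x7 0 5 = 1
x7 1 2 = 2
x7 3 4 = 2
x7 5 6 = 2
x7 2 0 = 1
x7 4 0 = 1
x7 6 0 = 1
x7 _ _ = 0

X₇ : Graph 7
X₇ i j = x7 (toℕ i) (toℕ j)

module Submission where

-- A finite list L of graphs witnesses that Γ is
-- mutation-finite as soon as (a) Γ is isomorphic to a member of L and
-- (b) L is mutation-closed: every mutation of every member of L is
-- isomorphic to a member of L.  Indeed, relabeling is an equivalence
-- relation and mutation commutes with relabeling (μ_{σ k} (σ Γ) = σ (μ_k Γ)),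
-- so "isomorphic to a member of L" is preserved by every elementary move
-- and hence along every mutation sequence (`closed⇒finite`).
--
-- Condition (b) is finite: for each member and each vertex we name the
-- member that the mutation is isomorphic to together with a relabeling
-- table and its inverse, and a decision procedure checks all of these
-- certificates by evaluation (`certified⇒closed`).  The theorem follows by
-- exhibiting the mutation classes: X₆ has five isomorphism classes, all
-- reached from X₆ by at most two mutations, and X₇ has two, X₇ and μ_x X₇.

open import Defs
open import Data.Nat using (ℕ)
import Data.Nat as ℕ
open import Data.Fin using (Fin; _≟_)
open import Data.Fin.Patterns
open import Data.Fin.Properties using (all?)
open import Data.Fin.Permutation
  using (Permutation′; _⟨$⟩ʳ_; _⟨$⟩ˡ_; permutation; id; flip; _∘ₚ_; inverseʳ)
open import Data.Product using (_×_; _,_; proj₁)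
open import Data.Vec using (Vec; []; _∷_; lookup; allFin)
open import Data.List using (List; []; _∷_; length)
import Data.List as List
open import Data.List.Relation.Unary.Any using (Any; here; index)
import Data.List.Relation.Unary.Any as Any
open import Data.List.Relation.Unary.Any.Properties using (lookup-index)
open import Data.List.Membership.Propositional using (lose)
open import Data.List.Membership.Propositional.Properties using (∈-lookup)
open import Function.Bundles using (Injection)
open import Function.Properties.Inverse using (↔⇒↣)
open import Relation.Nullary using (Dec; yes; no)
open import Relation.Nullary.Negation using (contradiction)
open import Relation.Nullary.Decidable using (True; toWitness; _×-dec_)
open import Relation.Binary.PropositionalEquality using (_≡_; refl; sym; trans; cong; cong₂)
open import Relation.Binary.Construct.Closure.ReflexiveTransitive using (ε; _◅_)

private
  variable
    n : ℕ
    Γ Δ Θ : Graph n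

Iso-refl : Iso Γ Γ
Iso-refl = id , λ i j → refl

Iso-sym : Iso Γ Δ → Iso Δ Γ
Iso-sym {Δ = Δ} (σ , e) =
  flip σ , λ i j → trans (sym (e (σ ⟨$⟩ˡ i) (σ ⟨$⟩ˡ j))) (cong₂ Δ (inverseʳ σ) (inverseʳ σ))

Iso-trans : Iso Γ Δ → Iso Δ Θ → Iso Γ Θ
Iso-trans (σ , e) (τ , f) = σ ∘ₚ τ , λ i j → trans (f (σ ⟨$⟩ʳ i) (σ ⟨$⟩ʳ j)) (e i j)

σ-injective : (σ : Permutation′ n) {i j : Fin n} → σ ⟨$⟩ʳ i ≡ σ ⟨$⟩ʳ j → i ≡ j
σ-injective σ = Injection.injective (↔⇒↣ σ)

-- The case analysis of `mutate` on whether i and j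
-- equal k takes the same branches on both sides because σ is injective.
mutate-relabel : (σ : Permutation′ n) → (∀ i j → Δ (σ ⟨$⟩ʳ i) (σ ⟨$⟩ʳ j) ≡ Γ i j) →
                 ∀ k i j → mutate (σ ⟨$⟩ʳ k) Δ (σ ⟨$⟩ʳ i) (σ ⟨$⟩ʳ j) ≡ mutate k Γ i j
mutate-relabel σ e k i j
  with i ≟ k | σ ⟨$⟩ʳ i ≟ σ ⟨$⟩ʳ k | j ≟ k | σ ⟨$⟩ʳ j ≟ σ ⟨$⟩ʳ k
... | yes _   | yes _     | _       | _         = e j i
... | yes i≡k | no σi≢σk  | _       | _         = contradiction (cong (σ ⟨$⟩ʳ_) i≡k) σi≢σk
... | no i≢k  | yes σi≡σk | _       | _         = contradiction (σ-injective σ σi≡σk) i≢k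
... | no _    | no _      | yes _   | yes _     = e j i
... | no _    | no _      | yes j≡k | no σj≢σk  = contradiction (cong (σ ⟨$⟩ʳ_) j≡k) σj≢σk
... | no _    | no _      | no j≢k  | yes σj≡σk = contradiction (σ-injective σ σj≡σk) j≢k
... | no _    | no _      | no _    | no _      =
  cong₂ ℕ._∸_ (cong₂ ℕ._+_ (e i j) (cong₂ ℕ._*_ (e i k) (e k j)))
              (cong₂ ℕ._+_ (e j i) (cong₂ ℕ._*_ (e j k) (e k i)))

mutate-Iso : (k : Fin n) (s : Iso Γ Δ) → Iso (mutate k Γ) (mutate (proj₁ s ⟨$⟩ʳ k) Δ)
mutate-Iso k (σ , e) = σ , mutate-relabel σ e k

transport : {L : List (Graph n)} → Iso Γ Δ → Any (Iso Γ) L → Any (Iso Δ) L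
transport {Γ = Γ} {Δ} s = Any.map λ {Θ} → Iso-trans {Γ = Δ} {Γ} {Θ} (Iso-sym s)

MutationClosed : List (Graph n) → Set
MutationClosed L = ∀ i k → Any (Iso (mutate k (List.lookup L i))) L

module _ {L : List (Graph n)} (closed : MutationClosed L) where

  move-preserves : Move Γ Δ → Any (Iso Γ) L → Any (Iso Δ) L
  move-preserves (relab s) Γ∼L = transport s Γ∼L
  move-preserves (mut k)   Γ∼L =
    transport (Iso-sym (mutate-Iso k Γ≅member)) (closed (index Γ∼L) (proj₁ Γ≅member ⟨$⟩ʳ k))
    where Γ≅member = lookup-index Γ∼L

  mutEquiv-preserves : MutEquiv Γ Δ → Any (Iso Γ) L → Any (Iso Δ) L
  mutEquiv-preserves ε            Γ∼L = Γ∼L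
  mutEquiv-preserves (m ◅ steps) Γ∼L = mutEquiv-preserves steps (move-preserves m Γ∼L)

  closed⇒finite : Any (Iso Γ) L → MutationFinite Γ
  closed⇒finite Γ∼L = L , λ Δ steps → mutEquiv-preserves steps Γ∼L

-- A permutation of Fin n is presented by a table
-- `to` together with its inverse table `from`; that it is a permutation
-- carrying Γ to Δ is a decidable property, checked by evaluation.
IsRelabeling : (Γ Δ : Graph n) (to from : Vec (Fin n) n) → Set
IsRelabeling Γ Δ to from =
  (∀ y → lookup to (lookup from y) ≡ y) ×
  (∀ x → lookup from (lookup to x) ≡ x) ×
  (∀ i j → Δ (lookup to i) (lookup to j) ≡ Γ i j)

isRelabeling? : (Γ Δ : Graph n) (to from : Vec (Fin n) n) → Dec (IsRelabeling Γ Δ to from)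
isRelabeling? Γ Δ to from =
  all? (λ y → lookup to (lookup from y) ≟ y) ×-dec
  all? (λ x → lookup from (lookup to x) ≟ x) ×-dec
  all? (λ i → all? λ j → Δ (lookup to i) (lookup to j) ℕ.≟ Γ i j)

relabeling⇒Iso : (to from : Vec (Fin n) n) → IsRelabeling Γ Δ to from → Iso Γ Δ
relabeling⇒Iso to from (to∘from , from∘to , arrows) =
  permutation (lookup to) (lookup from) to∘from from∘to , arrows

record Certificate (m n : ℕ) : Set where
  constructor ⟨_,_,_⟩
  field
    target   : Fin m
    to from  : Vec (Fin n) n

ι : Vec (Fin n) n
ι = allFin _

Certifies : (L : List (Graph n)) → (Fin (length L) → Fin n → Certificate (length L) n) → Set
Certifies L cert = ∀ i k → let open Certificate (cert i k) in
  IsRelabeling (mutate k (List.lookup L i)) (List.lookup L target) to from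

certifies? : (L : List (Graph n)) (cert : Fin (length L) → Fin n → Certificate (length L) n) →
             Dec (Certifies L cert)
certifies? L cert = all? λ i → all? λ k → let open Certificate (cert i k) in
  isRelabeling? (mutate k (List.lookup L i)) (List.lookup L target) to from

certified⇒closed : (L : List (Graph n)) (cert : Fin (length L) → Fin n → Certificate (length L) n) →
                   {ok : True (certifies? L cert)} → MutationClosed L
certified⇒closed L cert {ok} i k =
  let open Certificate (cert i k) in
  lose (∈-lookup target) (relabeling⇒Iso {Δ = List.lookup L target} to from (toWitness ok i k))

involution : ∀ {m} → Fin m → Vec (Fin n) n → Certificate m n
involution t v = ⟨ t , v , v ⟩

unchanged : ∀ {m} → Fin m → Certificate m n
unchanged t = ⟨ t , ι , ι ⟩

class₆ : List (Graph 6)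
class₆ = X₆ ∷ mutate 0F X₆ ∷ mutate 5F X₆ ∷ mutate 1F (mutate 0F X₆) ∷ mutate 5F (mutate 0F X₆) ∷ []

certificates₆ : Fin 5 → Fin 6 → Certificate 5 6
certificates₆ 0F 0F = unchanged 1F
certificates₆ 0F 1F = involution 0F (0F ∷ 2F ∷ 1F ∷ 3F ∷ 4F ∷ 5F ∷ [])
certificates₆ 0F 2F = involution 0F (0F ∷ 2F ∷ 1F ∷ 3F ∷ 4F ∷ 5F ∷ [])
certificates₆ 0F 3F = involution 0F (0F ∷ 1F ∷ 2F ∷ 4F ∷ 3F ∷ 5F ∷ [])
certificates₆ 0F 4F = involution 0F (0F ∷ 1F ∷ 2F ∷ 4F ∷ 3F ∷ 5F ∷ [])
certificates₆ 0F 5F = unchanged 2F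
certificates₆ 1F 0F = unchanged 0F
certificates₆ 1F 1F = unchanged 3F
certificates₆ 1F 2F = ⟨ 3F , 1F ∷ 2F ∷ 0F ∷ 3F ∷ 4F ∷ 5F ∷ [] , 2F ∷ 0F ∷ 1F ∷ 3F ∷ 4F ∷ 5F ∷ [] ⟩
certificates₆ 1F 3F = involution 3F (0F ∷ 3F ∷ 4F ∷ 1F ∷ 2F ∷ 5F ∷ [])
certificates₆ 1F 4F = ⟨ 3F , 1F ∷ 3F ∷ 4F ∷ 2F ∷ 0F ∷ 5F ∷ [] , 4F ∷ 0F ∷ 3F ∷ 1F ∷ 2F ∷ 5F ∷ [] ⟩
certificates₆ 1F 5F = unchanged 4F
certificates₆ 2F 0F = ⟨ 3F , 2F ∷ 0F ∷ 1F ∷ 5F ∷ 3F ∷ 4F ∷ [] , 1F ∷ 2F ∷ 0F ∷ 4F ∷ 5F ∷ 3F ∷ [] ⟩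
certificates₆ 2F 1F = involution 2F (0F ∷ 2F ∷ 1F ∷ 3F ∷ 4F ∷ 5F ∷ [])
certificates₆ 2F 2F = involution 2F (0F ∷ 2F ∷ 1F ∷ 3F ∷ 4F ∷ 5F ∷ [])
certificates₆ 2F 3F = involution 2F (0F ∷ 1F ∷ 2F ∷ 4F ∷ 3F ∷ 5F ∷ [])
certificates₆ 2F 4F = involution 2F (0F ∷ 1F ∷ 2F ∷ 4F ∷ 3F ∷ 5F ∷ [])
certificates₆ 2F 5F = unchanged 0F
certificates₆ 3F 0F = ⟨ 1F , 2F ∷ 0F ∷ 1F ∷ 3F ∷ 4F ∷ 5F ∷ [] , 1F ∷ 2F ∷ 0F ∷ 3F ∷ 4F ∷ 5F ∷ [] ⟩
certificates₆ 3F 1F = unchanged 1F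
certificates₆ 3F 2F = ⟨ 2F , 1F ∷ 2F ∷ 0F ∷ 4F ∷ 5F ∷ 3F ∷ [] , 2F ∷ 0F ∷ 1F ∷ 5F ∷ 3F ∷ 4F ∷ [] ⟩
certificates₆ 3F 3F = involution 1F (5F ∷ 1F ∷ 4F ∷ 3F ∷ 2F ∷ 0F ∷ [])
certificates₆ 3F 4F = ⟨ 4F , 0F ∷ 2F ∷ 4F ∷ 5F ∷ 1F ∷ 3F ∷ [] , 0F ∷ 4F ∷ 1F ∷ 5F ∷ 2F ∷ 3F ∷ [] ⟩
certificates₆ 3F 5F = ⟨ 1F , 5F ∷ 1F ∷ 3F ∷ 0F ∷ 2F ∷ 4F ∷ [] , 3F ∷ 1F ∷ 4F ∷ 2F ∷ 5F ∷ 0F ∷ [] ⟩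
certificates₆ 4F 0F = ⟨ 3F , 4F ∷ 0F ∷ 1F ∷ 5F ∷ 3F ∷ 2F ∷ [] , 1F ∷ 2F ∷ 5F ∷ 4F ∷ 0F ∷ 3F ∷ [] ⟩
certificates₆ 4F 1F = ⟨ 3F , 0F ∷ 4F ∷ 1F ∷ 5F ∷ 2F ∷ 3F ∷ [] , 0F ∷ 2F ∷ 4F ∷ 5F ∷ 1F ∷ 3F ∷ [] ⟩
certificates₆ 4F 2F = ⟨ 1F , 1F ∷ 3F ∷ 5F ∷ 0F ∷ 2F ∷ 4F ∷ [] , 3F ∷ 0F ∷ 4F ∷ 1F ∷ 5F ∷ 2F ∷ [] ⟩
certificates₆ 4F 3F = ⟨ 3F , 0F ∷ 5F ∷ 2F ∷ 4F ∷ 1F ∷ 3F ∷ [] , 0F ∷ 4F ∷ 2F ∷ 5F ∷ 3F ∷ 1F ∷ [] ⟩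
certificates₆ 4F 4F = involution 1F (1F ∷ 0F ∷ 2F ∷ 3F ∷ 5F ∷ 4F ∷ [])
certificates₆ 4F 5F = unchanged 1F

closed₆ : MutationClosed class₆
closed₆ = certified⇒closed class₆ certificates₆

class₇ : List (Graph 7)
class₇ = X₇ ∷ mutate 0F X₇ ∷ []

certificates₇ : Fin 2 → Fin 7 → Certificate 2 7
certificates₇ 0F 0F = unchanged 1F
certificates₇ 0F 1F = involution 0F (0F ∷ 2F ∷ 1F ∷ 3F ∷ 4F ∷ 5F ∷ 6F ∷ [])
certificates₇ 0F 2F = involution 0F (0F ∷ 2F ∷ 1F ∷ 3F ∷ 4F ∷ 5F ∷ 6F ∷ [])
certificates₇ 0F 3F = involution 0F (0F ∷ 1F ∷ 2F ∷ 4F ∷ 3F ∷ 5F ∷ 6F ∷ [])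
certificates₇ 0F 4F = involution 0F (0F ∷ 1F ∷ 2F ∷ 4F ∷ 3F ∷ 5F ∷ 6F ∷ [])
certificates₇ 0F 5F = involution 0F (0F ∷ 1F ∷ 2F ∷ 3F ∷ 4F ∷ 6F ∷ 5F ∷ [])
certificates₇ 0F 6F = involution 0F (0F ∷ 1F ∷ 2F ∷ 3F ∷ 4F ∷ 6F ∷ 5F ∷ [])
certificates₇ 1F 0F = unchanged 0F
certificates₇ 1F 1F = ⟨ 1F , 1F ∷ 2F ∷ 0F ∷ 4F ∷ 5F ∷ 6F ∷ 3F ∷ [] , 2F ∷ 0F ∷ 1F ∷ 6F ∷ 3F ∷ 4F ∷ 5F ∷ [] ⟩
certificates₇ 1F 2F = ⟨ 1F , 2F ∷ 0F ∷ 1F ∷ 4F ∷ 5F ∷ 6F ∷ 3F ∷ [] , 1F ∷ 2F ∷ 0F ∷ 6F ∷ 3F ∷ 4F ∷ 5F ∷ [] ⟩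
certificates₇ 1F 3F = ⟨ 1F , 1F ∷ 4F ∷ 5F ∷ 2F ∷ 0F ∷ 6F ∷ 3F ∷ [] , 4F ∷ 0F ∷ 3F ∷ 6F ∷ 1F ∷ 2F ∷ 5F ∷ [] ⟩
certificates₇ 1F 4F = ⟨ 1F , 2F ∷ 4F ∷ 5F ∷ 0F ∷ 1F ∷ 6F ∷ 3F ∷ [] , 3F ∷ 4F ∷ 0F ∷ 6F ∷ 1F ∷ 2F ∷ 5F ∷ [] ⟩
certificates₇ 1F 5F = ⟨ 1F , 1F ∷ 4F ∷ 5F ∷ 6F ∷ 3F ∷ 2F ∷ 0F ∷ [] , 6F ∷ 0F ∷ 5F ∷ 4F ∷ 1F ∷ 2F ∷ 3F ∷ [] ⟩
certificates₇ 1F 6F = ⟨ 1F , 2F ∷ 4F ∷ 5F ∷ 6F ∷ 3F ∷ 0F ∷ 1F ∷ [] , 5F ∷ 6F ∷ 0F ∷ 4F ∷ 1F ∷ 2F ∷ 3F ∷ [] ⟩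

closed₇ : MutationClosed class₇
closed₇ = certified⇒closed class₇ certificates₇

proposition1 : MutationFinite X₆ × MutationFinite X₇
proposition1 = closed⇒finite closed₆ (here Iso-refl) , closed⇒finite closed₇ (here Iso-refl)
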